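{- Let $a$ be a real number and $n\ge 0$ an integer. Then $$E_{n,a}(1-x)=\sum_{k=0}^n\binom nk(-1)^kE_{k,a}(x).$$
   Context: For a real number $a$, the sequence $\{E_{n,a}\}$ is defined by $E_{0,a}=1$ and $E_{n,a}=-a\sum_{k=1}^{\lfloor n/2\rfloor}\binom{n}{2k}E_{n-2k,a}$ for $n\ge 1$, and the polynomials $E_{n,a}(x)$ are defined by $E_{n,a}(x)=\sum_{k=0}^n\binom nk E_{k,a}x^{n-k}$ for $n\ge 0$. -}

module Defs where

open import Level using (Level)
open import Algebra.Bundles using (CommutativeRing)
open import Data.Nat as ℕ using (ℕ; zero; suc; _∸_; _≤?_)
open import Data.Nat.DivMod using (_/_)
open import Data.Nat.Combinatorics using (_C_)
open import Relation.Nullary using (yes; no)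

module _ {c ℓ : Level} (R : CommutativeRing c ℓ) where
  open CommutativeRing R

  natCast : ℕ → Carrier
  natCast zero    = 0#
  natCast (suc n) = 1# + natCast n

  pow : Carrier → ℕ → Carrier
  pow x zero    = 1#
  pow x (suc n) = x * pow x n

  sumBelow : ℕ → (ℕ → Carrier) → Carrier
  sumBelow zero    f = 0#
  sumBelow (suc m) f = sumBelow m f + f m

  sumTo : ℕ → (ℕ → Carrier) → Carrier
  sumTo m f = sumBelow (suc m) f

  -- the recursion step: given the values f j = E_{j,a} for j < n,
  -- returns  -a Σ_{k=1}^{⌊n/2⌋} C(n,2k) E_{n-2k,a}
  step : Carrier → ℕ → (ℕ → Carrier) → Carrier
  step a n f = - (a * sumBelow (n / 2)
                   (λ j → natCast (n C (2 ℕ.* suc j)) * f (n ∸ 2 ℕ.* suc j)))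

  -- table a n m = E_{m,a} for all m ≤ n
  table : Carrier → ℕ → ℕ → Carrier
  table a zero    m = 1#
  table a (suc n) m with m ≤? n
  ... | yes _ = table a n m
  ... | no  _ = step a m (table a n)

  E : Carrier → ℕ → Carrier
  E a n = table a n n

  Epoly : Carrier → ℕ → Carrier → Carrier
  Epoly a n x = sumTo n (λ k → natCast (n C k) * (E a k * pow x (n ∸ k)))

-- Write f ⋆ g for the binomial convolution (f ⋆ g) n = Σ_k C(n,k) f k g (n - k), so that
-- E_{n,a}(x) = (E_a ⋆ x^•) n.  It is associative (by induction, via the Leibniz rule
-- for the shift), and the binomial theorem reads (y + z)^• = y^• ⋆ z^•.  Hence
-- E_a ⋆ (1 - x)^• = (E_a ⋆ (-x)^•) ⋆ 1^•.  The recursion for E_{n,a} only refers to the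
-- values E_{n-2k,a}, so (-1)^n E_{n,a} = E_{n,a} for all n, and then every term of
-- (E_a ⋆ (-x)^•) k picks up the same sign: it equals (-1)^k E_{k,a}(x).
module Submission where

open import Defs
open import Level using (Level)
open import Algebra.Bundles using (CommutativeRing)
open import Data.Nat using (ℕ)
open import Data.Nat.Combinatorics using (_C_)

open import Data.Nat.Base as ℕ using (zero; suc; _∸_; _≤_; _<_; z≤n; s≤s; s≤s⁻¹)
open import Data.Nat.Properties as ℕₚ using (_≤?_)
open import Data.Nat.DivMod using (_/_; m/n*n≤m)
open import Data.Nat.Combinatorics using (nCk+nC[k+1]≡[n+1]C[k+1]; k>n⇒nCk≡0)
open import Relation.Nullary using (yes; no)
open import Relation.Binary.PropositionalEquality as ≡ using (_≡_)
import Algebra.Properties.CommutativeSemigroup as CommutativeSemigroupProperties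

2*[1+j]≤m : ∀ {j m} → j < m / 2 → 2 ℕ.* suc j ≤ m
2*[1+j]≤m {j} {m} j<m/2 = begin
  2 ℕ.* suc j   ≤⟨ ℕₚ.*-monoʳ-≤ 2 j<m/2 ⟩
  2 ℕ.* (m / 2) ≡⟨ ℕₚ.*-comm 2 (m / 2) ⟩
  m / 2 ℕ.* 2   ≤⟨ m/n*n≤m m 2 ⟩
  m             ∎
  where open ℕₚ.≤-Reasoning

module _ {c ℓ : Level} (R : CommutativeRing c ℓ) where
  open CommutativeRing R
  open import Algebra.Properties.Ring ring using (-1*x≈-x; -‿involutive; -‿distribʳ-*)
  open import Algebra.Properties.CommutativeSemiring.Exp commutativeSemiring
    using (_^_; ^-homo-*; ^-distrib-*; ^-congˡ)
  open import Algebra.Properties.Semiring.Mult semiring using (_×_; ×-homo-+)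
  open import Algebra.Solver.Ring.NaturalCoefficients.Default commutativeSemiring
  open import Relation.Binary.Reasoning.Setoid setoid
  module + = CommutativeSemigroupProperties +-commutativeSemigroup
  module * = CommutativeSemigroupProperties *-commutativeSemigroup

  natCast≡×1# : ∀ n → natCast R n ≡ n × 1#
  natCast≡×1# zero    = ≡.refl
  natCast≡×1# (suc n) = ≡.cong (1# +_) (natCast≡×1# n)

  natCast-+ : ∀ m n → natCast R (m ℕ.+ n) ≈ natCast R m + natCast R n
  natCast-+ m n rewrite natCast≡×1# (m ℕ.+ n) | natCast≡×1# m | natCast≡×1# n = ×-homo-+ 1# m n

  pow≡^ : ∀ x n → pow R x n ≡ x ^ n
  pow≡^ x zero    = ≡.refl
  pow≡^ x (suc n) = ≡.cong (x *_) (pow≡^ x n)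

  pow-congˡ : ∀ {x y} n → x ≈ y → pow R x n ≈ pow R y n
  pow-congˡ {x} {y} n x≈y rewrite pow≡^ x n | pow≡^ y n = ^-congˡ n x≈y

  pow-homo-+ : ∀ x m n → pow R x (m ℕ.+ n) ≈ pow R x m * pow R x n
  pow-homo-+ x m n rewrite pow≡^ x (m ℕ.+ n) | pow≡^ x m | pow≡^ x n = ^-homo-* x m n

  pow-distrib-* : ∀ x y n → pow R (x * y) n ≈ pow R x n * pow R y n
  pow-distrib-* x y n rewrite pow≡^ (x * y) n | pow≡^ x n | pow≡^ y n = ^-distrib-* x y n

  pow-1# : ∀ n → pow R 1# n ≈ 1#
  pow-1# zero    = refl
  pow-1# (suc n) = trans (*-identityˡ _) (pow-1# n)

  sumBelow-cong : ∀ m {f g} → (∀ k → k < m → f k ≈ g k) → sumBelow R m f ≈ sumBelow R m g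
  sumBelow-cong zero    f≈g = refl
  sumBelow-cong (suc m) f≈g =
    +-cong (sumBelow-cong m (λ k k<m → f≈g k (ℕₚ.m<n⇒m<1+n k<m))) (f≈g m (ℕₚ.n<1+n m))

  sumBelow-distrib-+ : ∀ m f g →
    sumBelow R m (λ k → f k + g k) ≈ sumBelow R m f + sumBelow R m g
  sumBelow-distrib-+ zero    f g = sym (+-identityˡ 0#)
  sumBelow-distrib-+ (suc m) f g =
    trans (+-cong (sumBelow-distrib-+ m f g) refl) (+.interchange _ _ _ _)

  *-distribˡ-sumBelow : ∀ m s f → s * sumBelow R m f ≈ sumBelow R m (λ k → s * f k)
  *-distribˡ-sumBelow zero    s f = zeroʳ s
  *-distribˡ-sumBelow (suc m) s f =
    trans (distribˡ s _ _) (+-cong (*-distribˡ-sumBelow m s f) refl)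

  sumBelow-split-head : ∀ m f → sumBelow R (suc m) f ≈ f 0 + sumBelow R m (λ k → f (suc k))
  sumBelow-split-head zero    f = +-comm 0# (f 0)
  sumBelow-split-head (suc m) f = trans (+-cong (sumBelow-split-head m f) refl) (+-assoc _ _ _)

  sumTo-pascal : ∀ n (h : ℕ → Carrier) →
    sumTo R n (λ k → natCast R (suc n C suc k) * h k)
      ≈ sumTo R n (λ k → natCast R (n C k) * h k) + sumBelow R n (λ k → natCast R (n C suc k) * h k)
  sumTo-pascal n h = begin
      sumTo R n (λ k → natCast R (suc n C suc k) * h k)
    ≈⟨ sumBelow-cong (suc n) (λ k _ → pascal k) ⟩
      sumTo R n (λ k → natCast R (n C k) * h k + natCast R (n C suc k) * h k)
    ≈⟨ sumBelow-distrib-+ (suc n) _ _ ⟩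
      sumTo R n (λ k → natCast R (n C k) * h k) + (sumBelow R n upper + upper n)
    ≈⟨ +-cong refl (+-cong refl upper-last≈0) ⟩
      sumTo R n (λ k → natCast R (n C k) * h k) + (sumBelow R n upper + 0#)
    ≈⟨ +-cong refl (+-identityʳ _) ⟩
      sumTo R n (λ k → natCast R (n C k) * h k) + sumBelow R n upper
    ∎
    where
    upper : ℕ → Carrier
    upper k = natCast R (n C suc k) * h k
    pascal : ∀ k → natCast R (suc n C suc k) * h k ≈ natCast R (n C k) * h k + upper k
    pascal k = begin
        natCast R (suc n C suc k) * h k
      ≡⟨ ≡.cong (λ i → natCast R i * h k) (nCk+nC[k+1]≡[n+1]C[k+1] n k) ⟨
        natCast R (n C k ℕ.+ n C suc k) * h k
      ≈⟨ *-cong (natCast-+ (n C k) (n C suc k)) refl ⟩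
        (natCast R (n C k) + natCast R (n C suc k)) * h k
      ≈⟨ distribʳ _ _ _ ⟩
        natCast R (n C k) * h k + upper k
      ∎
    upper-last≈0 : upper n ≈ 0#
    upper-last≈0 = trans (reflexive (≡.cong (λ i → natCast R i * h n) (k>n⇒nCk≡0 (ℕₚ.n<1+n n))))
                         (zeroˡ (h n))

  infixl 7 _⋆_
  _⋆_ : (ℕ → Carrier) → (ℕ → Carrier) → ℕ → Carrier
  (f ⋆ g) n = sumTo R n (λ k → natCast R (n C k) * (f k * g (n ∸ k)))

  shift : (ℕ → Carrier) → ℕ → Carrier
  shift f n = f (suc n)

  ⋆-cong : ∀ {f f′ g g′} → (∀ m → f m ≈ f′ m) → (∀ m → g m ≈ g′ m) → ∀ n → (f ⋆ g) n ≈ (f′ ⋆ g′) n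
  ⋆-cong f≈f′ g≈g′ n = sumBelow-cong (suc n) (λ k _ → *-cong refl (*-cong (f≈f′ k) (g≈g′ (n ∸ k))))

  ⋆-zero : ∀ f g → (f ⋆ g) 0 ≈ f 0 * g 0
  ⋆-zero f g = trans (+-identityˡ _) (trans (*-cong (+-identityʳ 1#) refl) (*-identityˡ _))

  ⋆-distribˡ-+ : ∀ f g h n → (f ⋆ (λ m → g m + h m)) n ≈ (f ⋆ g) n + (f ⋆ h) n
  ⋆-distribˡ-+ f g h n = trans
    (sumBelow-cong (suc n) (λ k _ → trans (*-cong refl (distribˡ _ _ _)) (distribˡ _ _ _)))
    (sumBelow-distrib-+ (suc n) _ _)

  ⋆-distribʳ-+ : ∀ f g h n → ((λ m → f m + g m) ⋆ h) n ≈ (f ⋆ h) n + (g ⋆ h) n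
  ⋆-distribʳ-+ f g h n = trans
    (sumBelow-cong (suc n) (λ k _ → trans (*-cong refl (distribʳ _ _ _)) (distribˡ _ _ _)))
    (sumBelow-distrib-+ (suc n) _ _)

  ⋆-scaleˡ : ∀ s f g n → ((λ m → s * f m) ⋆ g) n ≈ s * (f ⋆ g) n
  ⋆-scaleˡ s f g n = trans
    (sumBelow-cong (suc n) (λ k _ →
      solve 4 (λ s c x y → c :* ((s :* x) :* y) := s :* (c :* (x :* y))) refl s _ _ _))
    (sym (*-distribˡ-sumBelow (suc n) s _))

  ⋆-scaleʳ : ∀ s f g n → (f ⋆ (λ m → s * g m)) n ≈ s * (f ⋆ g) n
  ⋆-scaleʳ s f g n = trans
    (sumBelow-cong (suc n) (λ k _ →
      solve 4 (λ s c x y → c :* (x :* (s :* y)) := s :* (c :* (x :* y))) refl s _ _ _))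
    (sym (*-distribˡ-sumBelow (suc n) s _))

  ⋆-suc : ∀ f g n → (f ⋆ g) (suc n) ≈ (shift f ⋆ g) n + (f ⋆ shift g) n
  ⋆-suc f g n = begin
      (f ⋆ g) (suc n)
    ≈⟨ sumBelow-split-head (suc n) _ ⟩
      head + sumTo R n (λ k → natCast R (suc n C suc k) * (f (suc k) * g (n ∸ k)))
    ≈⟨ +-cong refl (sumTo-pascal n _) ⟩
      head + ((shift f ⋆ g) n + sumBelow R n (λ k → natCast R (n C suc k) * (f (suc k) * g (n ∸ k))))
    ≈⟨ +.x∙yz≈y∙xz _ _ _ ⟩
      (shift f ⋆ g) n + (head + sumBelow R n (λ k → natCast R (n C suc k) * (f (suc k) * g (n ∸ k))))
    ≈⟨ +-cong refl (+-cong refl (sumBelow-cong n reindex)) ⟩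
      (shift f ⋆ g) n
        + (head + sumBelow R n (λ k → natCast R (n C suc k) * (f (suc k) * shift g (n ∸ suc k))))
    ≈⟨ +-cong refl (sumBelow-split-head n _) ⟨
      (shift f ⋆ g) n + (f ⋆ shift g) n
    ∎
    where
    head : Carrier
    head = natCast R 1 * (f 0 * g (suc n))
    reindex : ∀ k → k < n →
      natCast R (n C suc k) * (f (suc k) * g (n ∸ k))
        ≈ natCast R (n C suc k) * (f (suc k) * shift g (n ∸ suc k))
    reindex k k<n =
      reflexive (≡.cong (λ i → natCast R (n C suc k) * (f (suc k) * g i)) (ℕₚ.+-∸-assoc 1 k<n))

  ⋆-assoc : ∀ f g h n → (f ⋆ (g ⋆ h)) n ≈ ((f ⋆ g) ⋆ h) n
  ⋆-assoc f g h zero = begin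
      (f ⋆ (g ⋆ h)) 0       ≈⟨ ⋆-zero f (g ⋆ h) ⟩
      f 0 * (g ⋆ h) 0       ≈⟨ *-cong refl (⋆-zero g h) ⟩
      f 0 * (g 0 * h 0)     ≈⟨ *-assoc _ _ _ ⟨
      (f 0 * g 0) * h 0     ≈⟨ *-cong (⋆-zero f g) refl ⟨
      (f ⋆ g) 0 * h 0       ≈⟨ ⋆-zero (f ⋆ g) h ⟨
      ((f ⋆ g) ⋆ h) 0       ∎
  ⋆-assoc f g h (suc n) = begin
      (f ⋆ (g ⋆ h)) (suc n)
    ≈⟨ ⋆-suc f (g ⋆ h) n ⟩
      (shift f ⋆ (g ⋆ h)) n + (f ⋆ shift (g ⋆ h)) n
    ≈⟨ +-cong refl (⋆-cong (λ _ → refl) (⋆-suc g h) n) ⟩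
      (shift f ⋆ (g ⋆ h)) n + (f ⋆ (λ m → (shift g ⋆ h) m + (g ⋆ shift h) m)) n
    ≈⟨ +-cong refl (⋆-distribˡ-+ f (shift g ⋆ h) (g ⋆ shift h) n) ⟩
      (shift f ⋆ (g ⋆ h)) n + ((f ⋆ (shift g ⋆ h)) n + (f ⋆ (g ⋆ shift h)) n)
    ≈⟨ +-cong (⋆-assoc (shift f) g h n) (+-cong (⋆-assoc f (shift g) h n) (⋆-assoc f g (shift h) n)) ⟩
      ((shift f ⋆ g) ⋆ h) n + (((f ⋆ shift g) ⋆ h) n + ((f ⋆ g) ⋆ shift h) n)
    ≈⟨ +-assoc _ _ _ ⟨
      (((shift f ⋆ g) ⋆ h) n + ((f ⋆ shift g) ⋆ h) n) + ((f ⋆ g) ⋆ shift h) n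
    ≈⟨ +-cong (⋆-distribʳ-+ _ _ h n) refl ⟨
      ((λ m → (shift f ⋆ g) m + (f ⋆ shift g) m) ⋆ h) n + ((f ⋆ g) ⋆ shift h) n
    ≈⟨ +-cong (⋆-cong {g = h} {g′ = h} (⋆-suc f g) (λ _ → refl) n) refl ⟨
      (shift (f ⋆ g) ⋆ h) n + ((f ⋆ g) ⋆ shift h) n
    ≈⟨ ⋆-suc (f ⋆ g) h n ⟨
      ((f ⋆ g) ⋆ h) (suc n)
    ∎

  pow-+-binomial : ∀ y z n → pow R (y + z) n ≈ (pow R y ⋆ pow R z) n
  pow-+-binomial y z zero = sym (trans (⋆-zero (pow R y) (pow R z)) (*-identityˡ 1#))
  pow-+-binomial y z (suc n) = begin
      (y + z) * pow R (y + z) n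
    ≈⟨ *-cong refl (pow-+-binomial y z n) ⟩
      (y + z) * (pow R y ⋆ pow R z) n
    ≈⟨ distribʳ _ _ _ ⟩
      y * (pow R y ⋆ pow R z) n + z * (pow R y ⋆ pow R z) n
    ≈⟨ +-cong (⋆-scaleˡ y (pow R y) (pow R z) n) (⋆-scaleʳ z (pow R y) (pow R z) n) ⟨
      (shift (pow R y) ⋆ pow R z) n + (pow R y ⋆ shift (pow R z)) n
    ≈⟨ ⋆-suc (pow R y) (pow R z) n ⟨
      (pow R y ⋆ pow R z) (suc n)
    ∎

  ⋆-pow-1# : ∀ f n → (f ⋆ pow R 1#) n ≈ sumTo R n (λ k → natCast R (n C k) * f k)
  ⋆-pow-1# f n = sumBelow-cong (suc n) (λ k _ →
    *-cong refl (trans (*-cong refl (pow-1# (n ∸ k))) (*-identityʳ _)))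

  sign : ℕ → Carrier
  sign = pow R (- 1#)

  sign-double : ∀ k → sign (2 ℕ.* k) ≈ 1#
  sign-double k = begin
    sign (2 ℕ.* k)          ≡⟨ ≡.cong (λ i → sign (k ℕ.+ i)) (ℕₚ.+-identityʳ k) ⟩
    sign (k ℕ.+ k)          ≈⟨ pow-homo-+ (- 1#) k k ⟩
    sign k * sign k         ≈⟨ pow-distrib-* (- 1#) (- 1#) k ⟨
    pow R (- 1# * - 1#) k   ≈⟨ pow-congˡ k (trans (-1*x≈-x (- 1#)) (-‿involutive 1#)) ⟩
    pow R 1# k              ≈⟨ pow-1# k ⟩
    1#                      ∎

  sign-∸ : ∀ {m n} → m ≤ n → sign n ≈ sign m * sign (n ∸ m)
  sign-∸ {m} {n} m≤n =
    trans (reflexive (≡.cong sign (≡.sym (ℕₚ.m+[n∸m]≡n m≤n)))) (pow-homo-+ (- 1#) m (n ∸ m))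

  pow-neg : ∀ x n → pow R (- x) n ≈ sign n * pow R x n
  pow-neg x n = trans (pow-congˡ n (sym (-1*x≈-x x))) (pow-distrib-* (- 1#) x n)

  -- Equivalently: the exponential generating function of f is even.
  SignInvariant : (ℕ → Carrier) → Set ℓ
  SignInvariant f = ∀ k → sign k * f k ≈ f k

  step-sign : ∀ a m f → (∀ i → i < m → sign i * f i ≈ f i) → sign m * step R a m f ≈ step R a m f
  step-sign a m f f-inv = begin
      sign m * - (a * sumBelow R (m / 2) term)
    ≈⟨ -‿distribʳ-* (sign m) _ ⟨
      - (sign m * (a * sumBelow R (m / 2) term))
    ≈⟨ -‿cong (*.x∙yz≈y∙xz (sign m) a _) ⟩
      - (a * (sign m * sumBelow R (m / 2) term))
    ≈⟨ -‿cong (*-cong refl (*-distribˡ-sumBelow (m / 2) (sign m) term)) ⟩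
      - (a * sumBelow R (m / 2) (λ j → sign m * term j))
    ≈⟨ -‿cong (*-cong refl (sumBelow-cong (m / 2) signed-term)) ⟩
      - (a * sumBelow R (m / 2) term)
    ∎
    where
    term : ℕ → Carrier
    term j = natCast R (m C (2 ℕ.* suc j)) * f (m ∸ 2 ℕ.* suc j)
    signed-term : ∀ j → j < m / 2 → sign m * term j ≈ term j
    signed-term j j<m/2 = begin
        sign m * (natCast R (m C 2 ℕ.* suc j) * f i)
      ≈⟨ *.x∙yz≈y∙xz _ _ _ ⟩
        natCast R (m C 2 ℕ.* suc j) * (sign m * f i)
      ≈⟨ *-cong refl (*-cong (sign-∸ 2j+2≤m) refl) ⟩
        natCast R (m C 2 ℕ.* suc j) * ((sign (2 ℕ.* suc j) * sign i) * f i)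
      ≈⟨ *-cong refl (*-cong (trans (*-cong (sign-double (suc j)) refl) (*-identityˡ _)) refl) ⟩
        natCast R (m C 2 ℕ.* suc j) * (sign i * f i)
      ≈⟨ *-cong refl (f-inv i (ℕₚ.∸-monoʳ-< (s≤s z≤n) 2j+2≤m)) ⟩
        natCast R (m C 2 ℕ.* suc j) * f i
      ∎
      where
      i = m ∸ 2 ℕ.* suc j
      2j+2≤m = 2*[1+j]≤m j<m/2

  -- Induction on the size of the table: the recursion step only reads entries already in it.
  table-sign : ∀ a n m → m ≤ n → sign m * table R a n m ≈ table R a n m
  table-sign a zero    zero    z≤n   = *-identityˡ 1#
  table-sign a (suc n) m       m≤1+n with m ≤? n
  ... | yes m≤n = table-sign a n m m≤n
  ... | no  _   = step-sign a m (table R a n)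
                    (λ i i<m → table-sign a n i (s≤s⁻¹ (ℕₚ.<-≤-trans i<m m≤1+n)))

  E-signInvariant : ∀ a → SignInvariant (E R a)
  E-signInvariant a n = table-sign a n n ℕₚ.≤-refl

  ⋆-pow-neg : ∀ {f} → SignInvariant f → ∀ x n → (f ⋆ pow R (- x)) n ≈ sign n * (f ⋆ pow R x) n
  ⋆-pow-neg {f} f-inv x n =
    trans (sumBelow-cong (suc n) signed-term) (sym (*-distribˡ-sumBelow (suc n) (sign n) _))
    where
    signed-term : ∀ k → k < suc n →
      natCast R (n C k) * (f k * pow R (- x) (n ∸ k))
        ≈ sign n * (natCast R (n C k) * (f k * pow R x (n ∸ k)))
    signed-term k k<1+n = begin
        natCast R (n C k) * (f k * pow R (- x) (n ∸ k))
      ≈⟨ *-cong refl (*-cong (sym (f-inv k)) (pow-neg x (n ∸ k))) ⟩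
        natCast R (n C k) * ((sign k * f k) * (sign (n ∸ k) * pow R x (n ∸ k)))
      ≈⟨ solve 5 (λ c s f t p → c :* ((s :* f) :* (t :* p)) := (s :* t) :* (c :* (f :* p)))
               refl _ _ _ _ _ ⟩
        (sign k * sign (n ∸ k)) * (natCast R (n C k) * (f k * pow R x (n ∸ k)))
      ≈⟨ *-cong (sign-∸ (s≤s⁻¹ k<1+n)) refl ⟨
        sign n * (natCast R (n C k) * (f k * pow R x (n ∸ k)))
      ∎

  ⋆-pow-reflect : ∀ {f} → SignInvariant f → ∀ x n →
    (f ⋆ pow R (1# - x)) n ≈ sumTo R n (λ k → natCast R (n C k) * (sign k * (f ⋆ pow R x) k))
  ⋆-pow-reflect {f} f-inv x n = begin
      (f ⋆ pow R (1# - x)) n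
    ≈⟨ ⋆-cong (λ _ → refl) (λ m → trans (pow-congˡ m (+-comm 1# (- x))) (pow-+-binomial (- x) 1# m)) n ⟩
      (f ⋆ (pow R (- x) ⋆ pow R 1#)) n
    ≈⟨ ⋆-assoc f (pow R (- x)) (pow R 1#) n ⟩
      ((f ⋆ pow R (- x)) ⋆ pow R 1#) n
    ≈⟨ ⋆-cong {g = pow R 1#} {g′ = pow R 1#} (⋆-pow-neg f-inv x) (λ _ → refl) n ⟩
      ((λ k → sign k * (f ⋆ pow R x) k) ⋆ pow R 1#) n
    ≈⟨ ⋆-pow-1# _ n ⟩
      sumTo R n (λ k → natCast R (n C k) * (sign k * (f ⋆ pow R x) k))
    ∎

corollary2p1 : ∀ {c ℓ} (R : CommutativeRing c ℓ) (a : CommutativeRing.Carrier R) (n : ℕ)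
               (x : CommutativeRing.Carrier R) →
               let open CommutativeRing R in
               Epoly R a n (1# - x)
                 ≈ sumTo R n (λ k → natCast R (n C k) * (pow R (- 1#) k * Epoly R a k x))
corollary2p1 R a n x = ⋆-pow-reflect R (E-signInvariant R a) x n
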